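{- Let $G=(V,E)$ be a DAG, $v\in V$, $\ell:V\to\Sigma$ a labeling function, $S\in\Sigma^m$ a string, and let $PI_v$ be defined as below. Then $|PI_v|\le\mu_s(v)$.
   Context: A path is a sequence of distinct vertices joined consecutively by edges (including the empty path with empty label); its label is the concatenation of the labels of its vertices. A border of a string is a segment that is simultaneously a proper prefix and a proper suffix (the empty string counts). Indices $i<j$ in $\{0,\dots,m\}$ are prefix-incomparable if $S[1..i]$ is not a border of $S[1..j]$; a set is prefix-incomparable if all its pairs are. $B_v=\{i\in\{0,\dots,m\}:$ some path ending in $v$ has label $S[1..i]\}$, and $PI_v\subseteq B_v$ is the unique prefix-incomparable set such that each $i\in B_v$ equals some $j\in PI_v$ or $S[1..i]$ is a border of $S[1..j]$. $\mu_s(v)$ is the number of paths from a source (in-degree $0$ vertex) of $G$ to $v$. -}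

module Defs where

open import Data.Nat using (ℕ; zero; suc; _<_)
open import Data.Fin using (Fin; toℕ)
open import Data.Fin.Properties using (all?) renaming (_≟_ to _≟ᶠ_)
open import Data.Fin.Subset using (Subset; _∈_)
open import Data.Bool using (Bool; T)
open import Data.List using (List; []; _∷_; _++_; [_]; map; take; length; last; upTo; concatMap; filter)
open import Data.List.Relation.Unary.Linked using (Linked; linked?)
open import Data.List.Relation.Unary.Unique.Propositional using (Unique)
import Data.List.Relation.Unary.Unique.DecPropositional as UDec
open import Data.Maybe using (Maybe; just)
import Data.Maybe.Properties as MP
open import Data.Vec using (Vec; toList)
open import Data.Empty using (⊥)
open import Data.Product using (Σ; ∃; _×_; _,_)
open import Data.Sum using (_⊎_)
open import Relation.Binary.PropositionalEquality using (_≡_)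
open import Relation.Nullary using (¬_; Dec; yes; no; ¬?)
open import Relation.Nullary.Decidable using (T?; _×-dec_)
open import Relation.Unary using (Decidable)

-- Directed graphs on the vertex set Fin n, with a (decidable) edge
-- relation given by a Boolean adjacency function:  Edge E u w  means
-- there is an edge u → w.

Adj : ℕ → Set
Adj n = Fin n → Fin n → Bool

module _ {n : ℕ} (E : Adj n) where

  Edge : Fin n → Fin n → Set
  Edge u w = T (E u w)

  IsDAG : Set
  IsDAG = ∀ (u : Fin n) (p : List (Fin n)) → ¬ Linked Edge (u ∷ (p ++ [ u ]))

  IsPath : List (Fin n) → Set
  IsPath p = Unique p × Linked Edge p

  IsSource : Fin n → Set
  IsSource u = ∀ w → ¬ Edge w u

  StartsAtSource : List (Fin n) → Set
  StartsAtSource []      = ⊥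
  StartsAtSource (u ∷ _) = IsSource u

  SourcePathTo : Fin n → List (Fin n) → Set
  SourcePathTo v p = IsPath p × StartsAtSource p × last p ≡ just v

  sourcePathTo? : (v : Fin n) → Decidable (SourcePathTo v)
  sourcePathTo? v p =
    (UDec.unique? _≟ᶠ_ p ×-dec linked? (λ a b → T? (E a b)) p)
      ×-dec (startsAtSource? p ×-dec MP.≡-dec _≟ᶠ_ (last p) (just v))
    where
    startsAtSource? : Decidable StartsAtSource
    startsAtSource? []      = no (λ ())
    startsAtSource? (u ∷ _) = all? (λ w → ¬? (T? (E w u)))

  listsOfLength : ℕ → List (List (Fin n))
  listsOfLength zero    = [] ∷ []
  listsOfLength (suc k) =
    concatMap (λ xs → map (_∷ xs) (Data.List.allFin n)) (listsOfLength k)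

  -- all lists of vertices of length at most n (every path has length ≤ n,
  -- its vertices being distinct); each list occurs exactly once
  candidates : List (List (Fin n))
  candidates = concatMap listsOfLength (upTo (suc n))

  μs : Fin n → ℕ
  μs v = length (filter (sourcePathTo? v) candidates)

IsBorder : {Σ' : Set} → List Σ' → List Σ' → Set
IsBorder x y = length x < length y
             × (∃ λ z → x ++ z ≡ y)
             × (∃ λ z → z ++ x ≡ y)

-- S[1..i] for i ∈ {0,…,m}
pre : {Σ' : Set} {m : ℕ} → Vec Σ' m → Fin (suc m) → List Σ'
pre S i = take (toℕ i) (toList S)

module _ {Σ' : Set} {n : ℕ} (E : Adj n) (ℓ : Fin n → Σ') {m : ℕ} (S : Vec Σ' m) where

  label : List (Fin n) → List Σ'
  label p = map ℓ p

  -- B_v: indices i such that some path ending in v has label S[1..i];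
  -- the empty path (empty label) is included, so i = 0 always belongs.
  B : Fin n → Fin (suc m) → Set
  B v i = toℕ i ≡ 0
        ⊎ (∃ λ p → IsPath E p × last p ≡ just v × label p ≡ pre S i)

  PrefixIncomparable : Subset (suc m) → Set
  PrefixIncomparable P =
    ∀ i j → i ∈ P → j ∈ P → toℕ i < toℕ j → ¬ IsBorder (pre S i) (pre S j)

  IsPI : Fin n → Subset (suc m) → Set
  IsPI v P =
      (∀ i → i ∈ P → B v i)
    × PrefixIncomparable P
    × (∀ i → B v i → ∃ λ j → j ∈ P × (i ≡ j ⊎ IsBorder (pre S i) (pre S j)))

-- Each i ∈ PI_v is witnessed by a path ending in v with label S[1..i]; in a DAG
-- that path extends backwards to a path π from a source, whose label still ends
-- with S[1..i].  If two indices i < j shared π, then S[1..i] and S[1..j] would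
-- both be suffixes of the label of π, so S[1..i] would be a suffix, and hence a
-- border, of S[1..j], against prefix-incomparability.  So i ↦ π is injective.
module Submission where

open import Defs
open import Data.Nat using (ℕ; suc; _≤_)
open import Data.Fin using (Fin)
open import Data.Fin.Subset using (Subset; ∣_∣)
open import Data.Vec using (Vec)

open import Data.Nat using (zero; _<_; _+_; _⊓_; z≤n; s≤s)
open import Data.Nat.Properties
  using (≤-trans; <⇒≤; ≤-pred; n≮n; <-cmp; m≤m+n; +-suc; m≤n⇒m⊓n≡m)
open import Data.Fin using (toℕ; zero; suc; punchOut)
open import Data.Fin.Properties
  using (any?; toℕ<n; toℕ-injective; suc-injective; punchOut-injective; injective⇒≤)
import Data.Fin.Subset as Subset
open import Data.Bool using (true; false)
open import Data.List using (List; []; _∷_; _++_; [_]; map; take; drop; length; last; lookup; filter)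
open import Data.List.Properties
  using (length-take; take-take; take++drop≡id; ++-assoc; ++-identityʳ; map-++; ∷-injectiveʳ; length-++-≤ʳ)
open import Data.List.Membership.Propositional using (_∈_; _∉_)
open import Data.List.Membership.Propositional.Properties
  using (∈-filter⁺; ∈-concat⁺′; ∈-map⁺; ∈-allFin; ∈-upTo⁺; ∈-lookup)
open import Data.List.Membership.Setoid.Properties using (index-injective)
open import Data.List.Relation.Unary.Any using (here; there; index)
import Data.List.Relation.Unary.All as All
open import Data.List.Relation.Unary.All.Properties using (¬Any⇒All¬)
open import Data.List.Relation.Unary.AllPairs using ([]; _∷_)
open import Data.List.Relation.Unary.Linked using (Linked; [-]; _∷_)
open import Data.List.Relation.Unary.Unique.Propositional using (Unique)
open import Data.Vec using (toList)
open import Data.Vec.Properties using (length-toList)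
import Data.Vec as Vec
open import Data.Maybe using (just)
open import Data.Empty using (⊥)
open import Data.Product using (∃; _×_; _,_; proj₁; proj₂)
open import Data.Sum using (inj₁; inj₂)
open import Function.Definitions using (Injective)
open import Relation.Binary using (tri<; tri≈; tri>)
open import Relation.Binary.PropositionalEquality
  using (_≡_; refl; sym; trans; cong; subst; subst₂; setoid; module ≡-Reasoning)
open import Relation.Nullary using (yes; no; contradiction)
open import Relation.Nullary.Decidable using (T?)

∣p∣≤n-injective : ∀ {k n} (p : Subset k) (f : ∀ i → i Subset.∈ p → Fin n)
                → (∀ {i j} i∈p j∈p → f i i∈p ≡ f j j∈p → i ≡ j) → ∣ p ∣ ≤ n
∣p∣≤n-injective Vec.[] f f-inj = z≤n
∣p∣≤n-injective (false Vec.∷ p) f f-inj =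
  ∣p∣≤n-injective p (λ i i∈p → f (suc i) (Vec.there i∈p))
    (λ i∈p j∈p eq → suc-injective (f-inj (Vec.there i∈p) (Vec.there j∈p) eq))
∣p∣≤n-injective {n = zero} (true Vec.∷ p) f f-inj with () ← f zero Vec.here
∣p∣≤n-injective {n = suc n} (true Vec.∷ p) f f-inj =
  s≤s (∣p∣≤n-injective p (λ i i∈p → punchOut (f₀≢ i∈p))
        (λ i∈p j∈p eq → suc-injective
          (f-inj (Vec.there i∈p) (Vec.there j∈p) (punchOut-injective (f₀≢ i∈p) (f₀≢ j∈p) eq))))
  where
  f₀≢ : ∀ {i} (i∈p : i Subset.∈ p) → f zero Vec.here ≡ f (suc i) (Vec.there i∈p) → ⊥
  f₀≢ i∈p eq with () ← f-inj Vec.here (Vec.there i∈p) eq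

module _ {A : Set} where

  Unique⇒lookup-injective : ∀ {xs : List A} → Unique xs → Injective _≡_ _≡_ (lookup xs)
  Unique⇒lookup-injective (_ ∷ _) {zero} {zero} _ = refl
  Unique⇒lookup-injective (x∉xs ∷ _) {zero} {suc j} eq =
    contradiction eq (All.lookup x∉xs (∈-lookup j))
  Unique⇒lookup-injective (x∉xs ∷ _) {suc i} {zero} eq =
    contradiction (sym eq) (All.lookup x∉xs (∈-lookup i))
  Unique⇒lookup-injective (_ ∷ xs-unique) {suc i} {suc j} eq =
    cong suc (Unique⇒lookup-injective xs-unique eq)

  SuffixOf : List A → List A → Set
  SuffixOf xs ys = ∃ λ zs → zs ++ xs ≡ ys

  []-suffix : ∀ ys → SuffixOf [] ys
  []-suffix ys = ys , ++-identityʳ ys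

  shorter-suffix : ∀ {xs ys zs} → SuffixOf xs zs → SuffixOf ys zs → length xs ≤ length ys
                 → SuffixOf xs ys
  shorter-suffix {xs} {ys} (as , refl) (bs , eq) xs≤ys = go as bs eq
    where
    go : ∀ as bs → bs ++ ys ≡ as ++ xs → SuffixOf xs ys
    go as [] refl = as , refl
    go [] (b ∷ bs) refl = contradiction (≤-trans xs≤ys (length-++-≤ʳ ys {bs})) (n≮n _)
    go (a ∷ as) (b ∷ bs) eq = go as bs (∷-injectiveʳ eq)

module _ {n : ℕ} (E : Adj n) where

  path-length≤n : ∀ {p} → IsPath E p → length p ≤ n
  path-length≤n (p-unique , _) = injective⇒≤ (Unique⇒lookup-injective p-unique)

  walk-to-successor : ∀ {u w x xs} → Linked (Edge E) (u ∷ xs) → w ∈ u ∷ xs → Edge E w x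
               → ∃ λ p → Linked (Edge E) (u ∷ (p ++ [ x ]))
  walk-to-successor walk (here refl) w→x = [] , w→x ∷ [-]
  walk-to-successor [-] (there ()) _
  walk-to-successor (u→y ∷ walk) (there w∈) w→x with p , walk′ ← walk-to-successor walk w∈ w→x =
    _ ∷ p , u→y ∷ walk′

  ∈-listsOfLength : ∀ xs → xs ∈ listsOfLength E (length xs)
  ∈-listsOfLength [] = here refl
  ∈-listsOfLength (x ∷ xs) = ∈-concat⁺′ (∈-map⁺ (_∷ xs) (∈-allFin x)) (∈-map⁺ _ (∈-listsOfLength xs))

  ∈-sourcePaths : ∀ {v p} → SourcePathTo E v p → p ∈ filter (sourcePathTo? E v) (candidates E)
  ∈-sourcePaths {v} {p} source-path@(path , _) =
    ∈-filter⁺ (sourcePathTo? E v)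
      (∈-concat⁺′ (∈-listsOfLength p) (∈-map⁺ (listsOfLength E) (∈-upTo⁺ (s≤s (path-length≤n path)))))
      source-path

  module _ (acyclic : IsDAG E) where

    predecessor-∉-path : ∀ {u w xs} → IsPath E (u ∷ xs) → Edge E w u → w ∉ u ∷ xs
    predecessor-∉-path (_ , walk) w→u w∈ with p , cycle ← walk-to-successor walk w∈ w→u =
      acyclic _ p cycle

    ∷-path : ∀ {u w xs} → IsPath E (u ∷ xs) → Edge E w u → IsPath E (w ∷ u ∷ xs)
    ∷-path path@(unique , walk) w→u =
      ¬Any⇒All¬ _ (predecessor-∉-path path w→u) ∷ unique , w→u ∷ walk

    -- The fuel k runs out only if the path could outgrow n vertices, which a path cannot.
    extend-to-source : ∀ k {v u xs} → n ≤ k + length (u ∷ xs) → IsPath E (u ∷ xs)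
                     → last (u ∷ xs) ≡ just v → ∃ λ q → SourcePathTo E v (q ++ u ∷ xs)
    extend-to-source k {u = u} bound path ends-in-v with any? (λ w → T? (E w u))
    ... | no no-predecessor = [] , path , (λ w w→u → no-predecessor (w , w→u)) , ends-in-v
    extend-to-source zero bound path _ | yes (w , w→u) =
      contradiction (≤-trans (path-length≤n (∷-path path w→u)) bound) (n≮n _)
    extend-to-source (suc k) {v} {u} {xs} bound path ends-in-v | yes (w , w→u)
      with q , source-path ← extend-to-source k (subst (n ≤_) (sym (+-suc k _)) bound) (∷-path path w→u) ends-in-v =
      q ++ [ w ] , subst (SourcePathTo E v) (sym (++-assoc q [ w ] (u ∷ xs))) source-path

module _ {A : Set} {m : ℕ} (S : Vec A m) where

  length-pre : ∀ i → length (pre S i) ≡ toℕ i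
  length-pre i = begin
    length (take (toℕ i) (toList S))  ≡⟨ length-take (toℕ i) (toList S) ⟩
    toℕ i ⊓ length (toList S)         ≡⟨ cong (toℕ i ⊓_) (length-toList S) ⟩
    toℕ i ⊓ m                         ≡⟨ m≤n⇒m⊓n≡m (≤-pred (toℕ<n i)) ⟩
    toℕ i                             ∎
    where open ≡-Reasoning

  pre-prefix : ∀ {i j} → toℕ i ≤ toℕ j → ∃ λ zs → pre S i ++ zs ≡ pre S j
  pre-prefix {i} {j} i≤j = drop (toℕ i) (pre S j) , (begin
    pre S i ++ drop (toℕ i) (pre S j)                 ≡⟨ cong (_++ drop (toℕ i) (pre S j)) pre-i≡ ⟩
    take (toℕ i) (pre S j) ++ drop (toℕ i) (pre S j)  ≡⟨ take++drop≡id (toℕ i) (pre S j) ⟩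
    pre S j                                           ∎)
    where
    open ≡-Reasoning
    pre-i≡ : pre S i ≡ take (toℕ i) (pre S j)
    pre-i≡ = sym (trans (take-take (toℕ i) (toℕ j) (toList S))
                        (cong (λ k → take k (toList S)) (m≤n⇒m⊓n≡m i≤j)))

  common-suffix⇒border : ∀ {i j ws} → toℕ i < toℕ j → SuffixOf (pre S i) ws → SuffixOf (pre S j) ws
                       → IsBorder (pre S i) (pre S j)
  common-suffix⇒border {i} {j} i<j i-suffix j-suffix =
    shorter , pre-prefix (<⇒≤ i<j) , shorter-suffix i-suffix j-suffix (<⇒≤ shorter)
    where
    shorter : length (pre S i) < length (pre S j)
    shorter = subst₂ _<_ (sym (length-pre i)) (sym (length-pre j)) i<j

module _ {A : Set} {n : ℕ} (E : Adj n) (ℓ : Fin n → A) {m : ℕ} (S : Vec A m) where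

  incomparable-common-suffix⇒≡ : ∀ {P i j ws} → PrefixIncomparable E ℓ S P → i Subset.∈ P → j Subset.∈ P
                               → SuffixOf (pre S i) ws → SuffixOf (pre S j) ws → i ≡ j
  incomparable-common-suffix⇒≡ {i = i} {j} incomparable i∈P j∈P i-suffix j-suffix
    with <-cmp (toℕ i) (toℕ j)
  ... | tri< i<j _ _ = contradiction (common-suffix⇒border S i<j i-suffix j-suffix) (incomparable i j i∈P j∈P i<j)
  ... | tri≈ _ i≡j _ = toℕ-injective i≡j
  ... | tri> _ _ j<i = contradiction (common-suffix⇒border S j<i j-suffix i-suffix) (incomparable j i j∈P i∈P j<i)

  source-path-ending-with : IsDAG E → ∀ {v i} → B E ℓ S v i
                          → ∃ λ π → SourcePathTo E v π × SuffixOf (pre S i) (label E ℓ S π)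
  source-path-ending-with acyclic {v} {i} (inj₁ i≡0)
    with q , source-path ← extend-to-source E acyclic n (m≤m+n n 1) (All.[] ∷ [] , [-]) refl =
    q ++ [ v ] , source-path , subst (λ k → SuffixOf (take k (toList S)) _) (sym i≡0) ([]-suffix _)
  source-path-ending-with _ (inj₂ ([] , _ , () , _))
  source-path-ending-with acyclic {i = i} (inj₂ (u ∷ xs , path , ends-in-v , labelled))
    with q , source-path ← extend-to-source E acyclic n (m≤m+n n _) path ends-in-v =
    q ++ u ∷ xs , source-path , map ℓ q , (begin
      map ℓ q ++ pre S i         ≡⟨ cong (map ℓ q ++_) labelled ⟨
      map ℓ q ++ map ℓ (u ∷ xs)  ≡⟨ map-++ ℓ q (u ∷ xs) ⟨
      map ℓ (q ++ u ∷ xs)        ∎)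
    where open ≡-Reasoning

lemma23 : {Σ' : Set} (n : ℕ) (E : Adj n) → IsDAG E → (v : Fin n)
          → (ℓ : Fin n → Σ') (m : ℕ) (S : Vec Σ' m) (PIv : Subset (suc m))
          → IsPI E ℓ S v PIv → ∣ PIv ∣ ≤ μs E v
lemma23 n E acyclic v ℓ m S PIv (PIv⊆Bv , incomparable , _) =
  ∣p∣≤n-injective PIv (λ _ i∈PIv → index (position i∈PIv)) positions-injective
  where
  witness : ∀ {i} → i Subset.∈ PIv → ∃ λ π → SourcePathTo E v π × SuffixOf (pre S i) (label E ℓ S π)
  witness i∈PIv = source-path-ending-with E ℓ S acyclic (PIv⊆Bv _ i∈PIv)

  -- μs E v is the length of this list, so positions in it land in Fin (μs E v).
  position : ∀ {i} (i∈PIv : i Subset.∈ PIv) → proj₁ (witness i∈PIv) ∈ filter (sourcePathTo? E v) (candidates E)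
  position i∈PIv = ∈-sourcePaths E (proj₁ (proj₂ (witness i∈PIv)))

  positions-injective : ∀ {i j} (i∈PIv : i Subset.∈ PIv) (j∈PIv : j Subset.∈ PIv)
                      → index (position i∈PIv) ≡ index (position j∈PIv) → i ≡ j
  positions-injective i∈PIv j∈PIv same-index =
    incomparable-common-suffix⇒≡ E ℓ S incomparable i∈PIv j∈PIv
      (subst (λ π → SuffixOf _ (label E ℓ S π)) same-path (proj₂ (proj₂ (witness i∈PIv))))
      (proj₂ (proj₂ (witness j∈PIv)))
    where
    same-path : proj₁ (witness i∈PIv) ≡ proj₁ (witness j∈PIv)
    same-path = index-injective (setoid _) (position i∈PIv) (position j∈PIv) same-index
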